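{- Let $n\ge 3$ and let $\Gamma$ be the subgraph of $\mathrm{Cay}(\mathrm{Sym}_n,T_n)$ induced on $T_n$. If $\{u,v\}$ is an edge of $\Gamma$ forming a maximal clique of $\Gamma$ (i.e. no vertex of $\Gamma$ is adjacent to both $u$ and $v$), then $\{u,v\}=e_m$ for some $0\le m\le n$, where $e_l=\{\sigma(l,l+1,l+3),\sigma(l,l+2,l+3)\}$ for $0\le l\le n-3$, $e_{n-2}=\{\sigma(0,n-2,n-1),\sigma(0,n-2,n)\}$, $e_{n-1}=\{\sigma(1,n-1,n),\sigma(0,1,n-1)\}$, $e_n=\{\sigma(0,2,n),\sigma(1,2,n)\}$.
   Context: $\mathrm{Sym}_n$ is the symmetric group on $[n]$, permutations in one-line notation, $(\pi\circ\rho)(t)=\pi(\rho(t))$. For integers $0\le i<j<k\le n$ the block transposition $\sigma(i,j,k)$ is $[1\cdots i\ \ j+1\cdots k\ \ i+1\cdots j\ \ k+1\cdots n]$; $T_n$ is the set of all block transpositions. $\mathrm{Cay}(\mathrm{Sym}_n,T_n)$ has vertex set $\mathrm{Sym}_n$, with $\pi\sim\rho$ iff $\rho=\pi\circ\sigma$ for some $\sigma\in T_n$. -}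

module Defs where

open import Data.Nat using (ℕ; zero; suc; _+_; _∸_; _≤_; _<_)
open import Data.List using (List; []; _∷_; _++_; map; upTo)
open import Data.Product using (_×_; ∃-syntax)
open import Data.Sum using (_⊎_)
open import Relation.Binary.PropositionalEquality using (_≡_)

-- Permutations of [n] = {1,…,n} are represented in one-line notation as
-- lists of natural numbers [π(1), …, π(n)].

range : ℕ → ℕ → List ℕ
range a b = map (λ t → a + suc t) (upTo (b ∸ a))

-- block transposition σ(i,j,k) = [1⋯i  j+1⋯k  i+1⋯j  k+1⋯n]
σ : ℕ → ℕ → ℕ → ℕ → List ℕ
σ n i j k = range 0 i ++ range j k ++ range i j ++ range k n

-- value of a one-line permutation at the 1-based position t (0 if out of range)
at : List ℕ → ℕ → ℕ
at [] t = 0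
at (x ∷ xs) zero = 0
at (x ∷ xs) (suc zero) = x
at (x ∷ xs) (suc (suc t)) = at xs (suc t)

_∘ₚ_ : List ℕ → List ℕ → List ℕ
π ∘ₚ ρ = map (at π) ρ

InT : ℕ → List ℕ → Set
InT n π = ∃[ i ] ∃[ j ] ∃[ k ] (i < j × j < k × k ≤ n × π ≡ σ n i j k)

Adj : ℕ → List ℕ → List ℕ → Set
Adj n π ρ = ∃[ τ ] (InT n τ × ρ ≡ π ∘ₚ τ)

SamePair : List ℕ → List ℕ → List ℕ → List ℕ → Set
SamePair u v a b = (u ≡ a × v ≡ b) ⊎ (u ≡ b × v ≡ a)

IsSomeE : ℕ → List ℕ → List ℕ → Set
IsSomeE n u v =
  (∃[ l ] (l + 3 ≤ n × SamePair u v (σ n l (l + 1) (l + 3)) (σ n l (l + 2) (l + 3))))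
  ⊎ (SamePair u v (σ n 0 (n ∸ 2) (n ∸ 1)) (σ n 0 (n ∸ 2) n)
  ⊎ (SamePair u v (σ n 1 (n ∸ 1) n) (σ n 0 1 (n ∸ 1))
  ⊎ SamePair u v (σ n 0 2 n) (σ n 1 2 n)))

-- Write v = u ∘ τ with u = σ(i,j,k) and τ = σ(a,b,c). A block transposition has exactly three
-- breakpoints (positions x with π(x+1) ≠ π(x)+1). In u ∘ τ each junction of τ is a breakpoint unless
-- it joins two breakpoints of u that follow each other in u, and each breakpoint of u missed by τ pulls
-- back to a further breakpoint. As v has only three, two of a, b, c land on breakpoints of u in one of
-- five ways, and computing the products shows that, up to order, v arises from u by moving one cut
-- (σ(i',j,k), σ(i,j',k), σ(i,j,k')) or is σ(j,k,l). For such an edge, moving the free cut to a third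
-- position gives a common neighbour; this fails exactly when the cut is pinned between its neighbours
-- and the ends 0 and n, which are the edges e_0, …, e_n.

module Submission where

open import Defs
open import Data.Nat
open import Data.Nat.Properties
open import Data.Nat.Tactic.RingSolver using (solve)
open import Data.List using (List; []; _∷_; _++_; map; applyUpTo; upTo; length)
open import Data.List.Properties using (map-++; ++-assoc; length-++; map-upTo; ++-identityʳ)
open import Data.Product using (_×_; ∃-syntax; _,_; proj₁; proj₂)
open import Data.Sum using (_⊎_; inj₁; inj₂)
open import Data.Empty using (⊥; ⊥-elim)
open import Relation.Nullary using (¬_; Dec; yes; no)
open import Relation.Nullary.Decidable using (_⊎-dec_)
open import Relation.Binary.PropositionalEquality
open import Relation.Binary.Definitions using (tri<; tri≈; tri>)
open import Function using (_∘_)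
open import Algebra.Properties.CommutativeSemigroup +-commutativeSemigroup using (xy∙z≈xz∙y)

-- Block transpositions as concatenated blocks

block : ℕ → ℕ → List ℕ
block x zero    = []
block x (suc d) = suc x ∷ block (suc x) d

length-block : ∀ x d → length (block x d) ≡ d
length-block x zero    = refl
length-block x (suc d) = cong suc (length-block (suc x) d)

block-++ : ∀ x d e → block x (d + e) ≡ block x d ++ block (x + d) e
block-++ x zero    e = cong (λ y → block y e) (sym (+-identityʳ x))
block-++ x (suc d) e = cong (suc x ∷_) (trans (block-++ (suc x) d e) (cong (λ y → block (suc x) d ++ block y e) (sym (+-suc x d))))

applyUpTo-block : ∀ (f : ℕ → ℕ) x d → (∀ t → f t ≡ x + suc t) → applyUpTo f d ≡ block x d
applyUpTo-block f x zero    f≗ = refl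
applyUpTo-block f x (suc d) f≗ =
  cong₂ _∷_ (trans (f≗ 0) (+-comm x 1)) (applyUpTo-block (f ∘ suc) (suc x) d (λ t → trans (f≗ (suc t)) (+-suc x (suc t))))

range-block : ∀ x d → range x (x + d) ≡ block x d
range-block x d = begin
  map (λ t → x + suc t) (upTo (x + d ∸ x)) ≡⟨ map-upTo _ (x + d ∸ x) ⟩
  applyUpTo (λ t → x + suc t) (x + d ∸ x)         ≡⟨ applyUpTo-block _ x (x + d ∸ x) (λ _ → refl) ⟩
  block x (x + d ∸ x)                              ≡⟨ cong (block x) (m+n∸m≡n x d) ⟩
  block x d                                        ∎
  where open ≡-Reasoning

σ≡blocks : ∀ {n j k} i P Q R → i + P ≡ j → j + Q ≡ k → k + R ≡ n →
  σ n i j k ≡ block 0 i ++ block j Q ++ block i P ++ block k R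
σ≡blocks i P Q R refl refl refl =
  cong₂ _++_ (range-block 0 i) (cong₂ _++_ (range-block (i + P) Q) (cong₂ _++_ (range-block i P) (range-block (i + P + Q) R)))

at-zero : ∀ u → at u 0 ≡ 0
at-zero []      = refl
at-zero (x ∷ u) = refl

at-∘ₚ : ∀ u τ x → at (u ∘ₚ τ) x ≡ at u (at τ x)
at-∘ₚ u []      x             = sym (at-zero u)
at-∘ₚ u (y ∷ τ) zero          = sym (at-zero u)
at-∘ₚ u (y ∷ τ) (suc zero)    = refl
at-∘ₚ u (y ∷ τ) (suc (suc x)) = at-∘ₚ u τ (suc x)

map-at-∷-block : ∀ x (W : List ℕ) l d → map (at (x ∷ W)) (block (suc l) d) ≡ map (at W) (block l d)
map-at-∷-block x W l zero    = refl
map-at-∷-block x W l (suc d) = cong (at W (suc l) ∷_) (map-at-∷-block x W (suc l) d)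

map-at-block-prefix : ∀ (Y Z : List ℕ) → map (at (Y ++ Z)) (block 0 (length Y)) ≡ Y
map-at-block-prefix []      Z = refl
map-at-block-prefix (y ∷ Y) Z = cong (y ∷_) (trans (map-at-∷-block y (Y ++ Z) 0 (length Y)) (map-at-block-prefix Y Z))

map-at-block : ∀ (X Y Z : List ℕ) → map (at (X ++ Y ++ Z)) (block (length X) (length Y)) ≡ Y
map-at-block []      Y Z = map-at-block-prefix Y Z
map-at-block (x ∷ X) Y Z = trans (map-at-∷-block x (X ++ Y ++ Z) (length X) (length Y)) (map-at-block X Y Z)

map-++₄ : ∀ {A B : Set} (f : A → B) W X Y Z → map f (W ++ X ++ Y ++ Z) ≡ map f W ++ map f X ++ map f Y ++ map f Z
map-++₄ f W X Y Z = trans (map-++ f W _) (cong (map f W ++_) (trans (map-++ f X _) (cong (map f X ++_) (map-++ f Y Z))))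

++-∘ₚ-σ : ∀ (A B C D : List ℕ) {n a b c} →
  length A ≡ a → a + length B ≡ b → b + length C ≡ c → c + length D ≡ n →
  (A ++ B ++ C ++ D) ∘ₚ σ n a b c ≡ A ++ C ++ B ++ D
++-∘ₚ-σ A B C D refl refl refl refl = begin
    map (at s) (σ _ a b c)
  ≡⟨ cong (map (at s)) (σ≡blocks a (length B) (length C) (length D) refl refl refl) ⟩
    map (at s) (block 0 a ++ block b (length C) ++ block a (length B) ++ block c (length D))
  ≡⟨ map-++₄ (at s) (block 0 a) (block b (length C)) (block a (length B)) (block c (length D)) ⟩
    map (at s) (block 0 a) ++ map (at s) (block b (length C)) ++ map (at s) (block a (length B)) ++ map (at s) (block c (length D))
  ≡⟨ cong₂ _++_ (map-at-block [] A _) (cong₂ _++_ atC (cong₂ _++_ (map-at-block A B _) atD)) ⟩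
    A ++ C ++ B ++ D
  ∎
  where
  open ≡-Reasoning
  s : List ℕ
  s = A ++ B ++ C ++ D
  a : ℕ
  a = length A
  b : ℕ
  b = a + length B
  c : ℕ
  c = b + length C
  atC : map (at s) (block b (length C)) ≡ C
  atC = trans (cong₂ (λ w l → map (at w) (block l (length C))) (sym (++-assoc A B (C ++ D))) (sym (length-++ A)))
              (map-at-block (A ++ B) C D)
  atD : map (at s) (block c (length D)) ≡ D
  atD = trans (cong₂ (λ w l → map (at w) (block l (length D))) s≡ (sym (trans (length-++ (A ++ B)) (cong (_+ length C) (length-++ A)))))
              (map-at-block ((A ++ B) ++ C) D [])
    where
    s≡ : s ≡ ((A ++ B) ++ C) ++ D ++ []
    s≡ = begin
      A ++ B ++ C ++ D          ≡⟨ sym (++-assoc A B (C ++ D)) ⟩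
      (A ++ B) ++ C ++ D        ≡⟨ sym (++-assoc (A ++ B) C D) ⟩
      ((A ++ B) ++ C) ++ D      ≡⟨ cong (((A ++ B) ++ C) ++_) (sym (++-identityʳ D)) ⟩
      ((A ++ B) ++ C) ++ D ++ [] ∎

-- Products of two block transpositions

length-block₂ : ∀ x d y e → length (block x d ++ block y e) ≡ d + e
length-block₂ x d y e = trans (length-++ (block x d)) (cong₂ _+_ (length-block x d) (length-block y e))

length-offset : ∀ {a ℓ x b} → ℓ ≡ x → a + x ≡ b → a + ℓ ≡ b
length-offset refl e = e

σ-raise-i : ∀ {n i j k x y z i'} d e Q R →
  i + (d + e) ≡ j → j + Q ≡ k → k + R ≡ n → i ≡ x → i + Q ≡ y → i + Q + d ≡ z → i + d ≡ i' →
  σ n i j k ∘ₚ σ n x y z ≡ σ n i' j k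
σ-raise-i {i = i} d e Q R refl refl refl refl refl refl refl = begin
    σ n i j k ∘ₚ τ
  ≡⟨ cong (_∘ₚ τ) (σ≡blocks i (d + e) Q R refl refl refl) ⟩
    (block 0 i ++ block j Q ++ block i (d + e) ++ block k R) ∘ₚ τ
  ≡⟨ cong (λ w → (block 0 i ++ block j Q ++ w) ∘ₚ τ) (trans (cong (_++ block k R) (block-++ i d e)) (++-assoc (block i d) (block (i + d) e) (block k R))) ⟩
    (block 0 i ++ block j Q ++ block i d ++ (block (i + d) e ++ block k R)) ∘ₚ τ
  ≡⟨ ++-∘ₚ-σ (block 0 i) (block j Q) (block i d) (block (i + d) e ++ block k R)
       (length-block 0 i) (cong (i +_) (length-block j Q)) (cong (i + Q +_) (length-block i d))
       (length-offset (length-block₂ (i + d) e k R) rearrange) ⟩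
    block 0 i ++ block i d ++ block j Q ++ block (i + d) e ++ block k R
  ≡⟨ trans (sym (++-assoc (block 0 i) (block i d) rest)) (cong (_++ rest) (sym (block-++ 0 i d))) ⟩
    block 0 (i + d) ++ block j Q ++ block (i + d) e ++ block k R
  ≡⟨ sym (σ≡blocks (i + d) e Q R (+-assoc i d e) refl refl) ⟩
    σ n (i + d) j k
  ∎
  where
  open ≡-Reasoning
  j : ℕ
  j = i + (d + e)
  k : ℕ
  k = j + Q
  n : ℕ
  n = k + R
  τ : List ℕ
  τ = σ n i (i + Q) (i + Q + d)
  rest : List ℕ
  rest = block j Q ++ block (i + d) e ++ block k R
  rearrange : i + Q + d + (e + R) ≡ i + (d + e) + Q + R
  rearrange = solve (i ∷ d ∷ e ∷ Q ∷ R ∷ [])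

σ-lower-i : ∀ {n i j k x y z} a d P Q R →
  a + d ≡ i → i + P ≡ j → j + Q ≡ k → k + R ≡ n → a ≡ x → i ≡ y → i + Q ≡ z →
  σ n i j k ∘ₚ σ n x y z ≡ σ n a j k
σ-lower-i a d P Q R refl refl refl refl refl refl refl = begin
    σ n i j k ∘ₚ τ
  ≡⟨ cong (_∘ₚ τ) (σ≡blocks i P Q R refl refl refl) ⟩
    (block 0 i ++ block j Q ++ block i P ++ block k R) ∘ₚ τ
  ≡⟨ cong (_∘ₚ τ) (trans (cong (_++ rest) (block-++ 0 a d)) (++-assoc (block 0 a) (block a d) rest)) ⟩
    (block 0 a ++ block a d ++ block j Q ++ (block i P ++ block k R)) ∘ₚ τ
  ≡⟨ ++-∘ₚ-σ (block 0 a) (block a d) (block j Q) (block i P ++ block k R)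
       (length-block 0 a) (cong (a +_) (length-block a d)) (cong (i +_) (length-block j Q))
       (length-offset (length-block₂ i P k R) rearrange) ⟩
    block 0 a ++ block j Q ++ block a d ++ block i P ++ block k R
  ≡⟨ cong (λ w → block 0 a ++ block j Q ++ w) (trans (sym (++-assoc (block a d) (block i P) (block k R))) (cong (_++ block k R) (sym (block-++ a d P)))) ⟩
    block 0 a ++ block j Q ++ block a (d + P) ++ block k R
  ≡⟨ sym (σ≡blocks a (d + P) Q R (sym (+-assoc a d P)) refl refl) ⟩
    σ n a j k
  ∎
  where
  open ≡-Reasoning
  i : ℕ
  i = a + d
  j : ℕ
  j = i + P
  k : ℕ
  k = j + Q
  n : ℕ
  n = k + R
  τ : List ℕ
  τ = σ n a i (i + Q)
  rest : List ℕ
  rest = block j Q ++ block i P ++ block k R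
  rearrange : a + d + Q + (P + R) ≡ a + d + P + Q + R
  rearrange = solve (a ∷ d ∷ P ∷ Q ∷ R ∷ [])

σ-raise-k : ∀ {n i j k x y z c} P Q e R →
  i + P ≡ j → j + Q ≡ k → k + e ≡ c → c + R ≡ n → i + Q ≡ x → k ≡ y → c ≡ z →
  σ n i j k ∘ₚ σ n x y z ≡ σ n i j c
σ-raise-k {i = i} P Q e R refl refl refl refl refl refl refl = begin
    σ n i j k ∘ₚ τ
  ≡⟨ cong (_∘ₚ τ) (σ≡blocks i P Q (e + R) refl refl (sym (+-assoc k e R))) ⟩
    (block 0 i ++ block j Q ++ block i P ++ block k (e + R)) ∘ₚ τ
  ≡⟨ cong (_∘ₚ τ) (trans (sym (++-assoc (block 0 i) (block j Q) (block i P ++ block k (e + R))))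
       (cong (λ w → (block 0 i ++ block j Q) ++ block i P ++ w) (block-++ k e R))) ⟩
    ((block 0 i ++ block j Q) ++ block i P ++ block k e ++ block c R) ∘ₚ τ
  ≡⟨ ++-∘ₚ-σ (block 0 i ++ block j Q) (block i P) (block k e) (block c R)
       (length-block₂ 0 i j Q) (length-offset (length-block i P) rearrange)
       (cong (k +_) (length-block k e)) (cong (c +_) (length-block c R)) ⟩
    (block 0 i ++ block j Q) ++ block k e ++ block i P ++ block c R
  ≡⟨ trans (++-assoc (block 0 i) (block j Q) (block k e ++ rest)) (cong (block 0 i ++_)
       (trans (sym (++-assoc (block j Q) (block k e) rest)) (cong (_++ rest) (sym (block-++ j Q e))))) ⟩
    block 0 i ++ block j (Q + e) ++ block i P ++ block c R
  ≡⟨ sym (σ≡blocks i P (Q + e) R refl (sym (+-assoc j Q e)) refl) ⟩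
    σ n i j c
  ∎
  where
  open ≡-Reasoning
  j : ℕ
  j = i + P
  k : ℕ
  k = j + Q
  c : ℕ
  c = k + e
  n : ℕ
  n = c + R
  τ : List ℕ
  τ = σ n (i + Q) k c
  rest : List ℕ
  rest = block i P ++ block c R
  rearrange : i + Q + P ≡ i + P + Q
  rearrange = solve (i ∷ Q ∷ P ∷ [])

σ-lower-k : ∀ {n i j k x y z k'} P d e R →
  i + P ≡ j → j + (d + e) ≡ k → k + R ≡ n → i + d ≡ x → i + (d + e) ≡ y → k ≡ z → j + d ≡ k' →
  σ n i j k ∘ₚ σ n x y z ≡ σ n i j k'
σ-lower-k {i = i} P d e R refl refl refl refl refl refl refl = begin
    σ n i j k ∘ₚ τ
  ≡⟨ cong (_∘ₚ τ) (σ≡blocks i P (d + e) R refl refl refl) ⟩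
    (block 0 i ++ block j (d + e) ++ block i P ++ block k R) ∘ₚ τ
  ≡⟨ cong (_∘ₚ τ) (trans (cong (λ w → block 0 i ++ w ++ rest) (block-++ j d e))
       (trans (cong (block 0 i ++_) (++-assoc (block j d) (block (j + d) e) rest))
              (sym (++-assoc (block 0 i) (block j d) (block (j + d) e ++ rest))))) ⟩
    ((block 0 i ++ block j d) ++ block (j + d) e ++ block i P ++ block k R) ∘ₚ τ
  ≡⟨ ++-∘ₚ-σ (block 0 i ++ block j d) (block (j + d) e) (block i P) (block k R)
       (length-block₂ 0 i j d) (length-offset (length-block (j + d) e) (+-assoc i d e))
       (length-offset (length-block i P) rearrange) (cong (k +_) (length-block k R)) ⟩
    (block 0 i ++ block j d) ++ block i P ++ block (j + d) e ++ block k R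
  ≡⟨ trans (++-assoc (block 0 i) (block j d) (block i P ++ block (j + d) e ++ block k R)) (cong (λ w → block 0 i ++ block j d ++ block i P ++ w)
       (sym (trans (block-++ (j + d) e R) (cong (λ m → block (j + d) e ++ block m R) (+-assoc j d e))))) ⟩
    block 0 i ++ block j d ++ block i P ++ block (j + d) (e + R)
  ≡⟨ sym (σ≡blocks i P d (e + R) refl refl rearrange′) ⟩
    σ n i j (j + d)
  ∎
  where
  open ≡-Reasoning
  j : ℕ
  j = i + P
  k : ℕ
  k = j + (d + e)
  n : ℕ
  n = k + R
  τ : List ℕ
  τ = σ n (i + d) (i + (d + e)) k
  rest : List ℕ
  rest = block i P ++ block k R
  rearrange′ : i + P + d + (e + R) ≡ i + P + (d + e) + R
  rearrange′ = solve (i ∷ P ∷ d ∷ e ∷ R ∷ [])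
  rearrange : i + (d + e) + P ≡ i + P + (d + e)
  rearrange = solve (i ∷ d ∷ e ∷ P ∷ [])

σ-raise-j : ∀ {n i j k x y z j'} P d e R →
  i + P ≡ j → j + (d + e) ≡ k → k + R ≡ n → i ≡ x → i + d ≡ y → k ≡ z → j + d ≡ j' →
  σ n i j k ∘ₚ σ n x y z ≡ σ n i j' k
σ-raise-j {i = i} P d e R refl refl refl refl refl refl refl = begin
    σ n i j k ∘ₚ τ
  ≡⟨ cong (_∘ₚ τ) (σ≡blocks i P (d + e) R refl refl refl) ⟩
    (block 0 i ++ block j (d + e) ++ block i P ++ block k R) ∘ₚ τ
  ≡⟨ cong (λ w → (block 0 i ++ w) ∘ₚ τ) (trans (cong (_++ rest) (block-++ j d e))
       (trans (++-assoc (block j d) (block (j + d) e) rest) (cong (block j d ++_) (sym (++-assoc (block (j + d) e) (block i P) (block k R)))))) ⟩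
    (block 0 i ++ block j d ++ (block (j + d) e ++ block i P) ++ block k R) ∘ₚ τ
  ≡⟨ ++-∘ₚ-σ (block 0 i) (block j d) (block (j + d) e ++ block i P) (block k R)
       (length-block 0 i) (cong (i +_) (length-block j d))
       (length-offset (length-block₂ (j + d) e i P) rearrange) (cong (k +_) (length-block k R)) ⟩
    block 0 i ++ (block (j + d) e ++ block i P) ++ block j d ++ block k R
  ≡⟨ cong (block 0 i ++_) (trans (++-assoc (block (j + d) e) (block i P) (block j d ++ block k R))
       (cong (block (j + d) e ++_) (trans (sym (++-assoc (block i P) (block j d) (block k R))) (cong (_++ block k R) (sym (block-++ i P d)))))) ⟩
    block 0 i ++ block (j + d) e ++ block i (P + d) ++ block k R
  ≡⟨ sym (σ≡blocks i (P + d) e R (sym (+-assoc i P d)) (+-assoc j d e) refl) ⟩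
    σ n i (j + d) k
  ∎
  where
  open ≡-Reasoning
  j : ℕ
  j = i + P
  k : ℕ
  k = j + (d + e)
  n : ℕ
  n = k + R
  τ : List ℕ
  τ = σ n i (i + d) k
  rest : List ℕ
  rest = block i P ++ block k R
  rearrange : i + d + (e + P) ≡ i + P + (d + e)
  rearrange = solve (i ∷ d ∷ e ∷ P ∷ [])

σ-lower-j : ∀ {n i j k x y z j'} d e Q R →
  i + (d + e) ≡ j → j + Q ≡ k → k + R ≡ n → i ≡ x → i + Q + d ≡ y → k ≡ z → i + d ≡ j' →
  σ n i j k ∘ₚ σ n x y z ≡ σ n i j' k
σ-lower-j {i = i} d e Q R refl refl refl refl refl refl refl = begin
    σ n i j k ∘ₚ τ
  ≡⟨ cong (_∘ₚ τ) (σ≡blocks i (d + e) Q R refl refl refl) ⟩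
    (block 0 i ++ block j Q ++ block i (d + e) ++ block k R) ∘ₚ τ
  ≡⟨ cong (λ w → (block 0 i ++ w) ∘ₚ τ) (trans (cong (λ w → block j Q ++ w ++ block k R) (block-++ i d e))
       (trans (cong (block j Q ++_) (++-assoc (block i d) (block (i + d) e) (block k R)))
              (sym (++-assoc (block j Q) (block i d) (block (i + d) e ++ block k R))))) ⟩
    (block 0 i ++ (block j Q ++ block i d) ++ block (i + d) e ++ block k R) ∘ₚ τ
  ≡⟨ ++-∘ₚ-σ (block 0 i) (block j Q ++ block i d) (block (i + d) e) (block k R)
       (length-block 0 i) (length-offset (length-block₂ j Q i d) (sym (+-assoc i Q d)))
       (length-offset (length-block (i + d) e) rearrange) (cong (k +_) (length-block k R)) ⟩
    block 0 i ++ block (i + d) e ++ (block j Q ++ block i d) ++ block k R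
  ≡⟨ cong (block 0 i ++_) (trans (cong (block (i + d) e ++_) (++-assoc (block j Q) (block i d) (block k R)))
       (trans (sym (++-assoc (block (i + d) e) (block j Q) rest)) (cong (_++ rest)
         (sym (trans (block-++ (i + d) e Q) (cong (λ m → block (i + d) e ++ block m Q) (+-assoc i d e))))))) ⟩
    block 0 i ++ block (i + d) (e + Q) ++ block i d ++ block k R
  ≡⟨ sym (σ≡blocks i d (e + Q) R refl rearrange′ refl) ⟩
    σ n i (i + d) k
  ∎
  where
  open ≡-Reasoning
  j : ℕ
  j = i + (d + e)
  k : ℕ
  k = j + Q
  n : ℕ
  n = k + R
  τ : List ℕ
  τ = σ n i (i + Q + d) k
  rest : List ℕ
  rest = block i d ++ block k R
  rearrange′ : i + d + (e + Q) ≡ i + (d + e) + Q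
  rearrange′ = solve (i ∷ d ∷ e ∷ Q ∷ [])
  rearrange : i + Q + d + e ≡ i + (d + e) + Q
  rearrange = solve (i ∷ d ∷ e ∷ Q ∷ [])

σ-advance : ∀ {n i j k x y z c} P Q e R →
  i + P ≡ j → j + Q ≡ k → k + e ≡ c → c + R ≡ n → i ≡ x → i + Q ≡ y → c ≡ z →
  σ n i j k ∘ₚ σ n x y z ≡ σ n j k c
σ-advance {i = i} P Q e R refl refl refl refl refl refl refl = begin
    σ n i j k ∘ₚ τ
  ≡⟨ cong (_∘ₚ τ) (σ≡blocks i P Q (e + R) refl refl (sym (+-assoc k e R))) ⟩
    (block 0 i ++ block j Q ++ block i P ++ block k (e + R)) ∘ₚ τ
  ≡⟨ cong (λ w → (block 0 i ++ block j Q ++ w) ∘ₚ τ) (trans (cong (block i P ++_) (block-++ k e R)) (sym (++-assoc (block i P) (block k e) (block c R)))) ⟩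
    (block 0 i ++ block j Q ++ (block i P ++ block k e) ++ block c R) ∘ₚ τ
  ≡⟨ ++-∘ₚ-σ (block 0 i) (block j Q) (block i P ++ block k e) (block c R)
       (length-block 0 i) (cong (i +_) (length-block j Q))
       (length-offset (length-block₂ i P k e) rearrange) (cong (c +_) (length-block c R)) ⟩
    block 0 i ++ (block i P ++ block k e) ++ block j Q ++ block c R
  ≡⟨ trans (cong (block 0 i ++_) (++-assoc (block i P) (block k e) rest))
       (trans (sym (++-assoc (block 0 i) (block i P) (block k e ++ rest))) (cong (_++ (block k e ++ rest)) (sym (block-++ 0 i P)))) ⟩
    block 0 j ++ block k e ++ block j Q ++ block c R
  ≡⟨ sym (σ≡blocks j Q e R refl refl refl) ⟩
    σ n j k c
  ∎
  where
  open ≡-Reasoning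
  j : ℕ
  j = i + P
  k : ℕ
  k = j + Q
  c : ℕ
  c = k + e
  n : ℕ
  n = c + R
  τ : List ℕ
  τ = σ n i (i + Q) c
  rest : List ℕ
  rest = block j Q ++ block c R
  rearrange : i + Q + (P + e) ≡ i + P + Q + e
  rearrange = solve (i ∷ Q ∷ P ∷ e ∷ [])

σ-retreat : ∀ {n i j k x y z} a d P Q R →
  a + d ≡ i → i + P ≡ j → j + Q ≡ k → k + R ≡ n → a ≡ x → i + Q ≡ y → k ≡ z →
  σ n i j k ∘ₚ σ n x y z ≡ σ n a i j
σ-retreat a d P Q R refl refl refl refl refl refl refl = begin
    σ n i j k ∘ₚ τ
  ≡⟨ cong (_∘ₚ τ) (σ≡blocks i P Q R refl refl refl) ⟩
    (block 0 i ++ block j Q ++ block i P ++ block k R) ∘ₚ τ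
  ≡⟨ cong (_∘ₚ τ) (trans (cong (_++ rest) (block-++ 0 a d))
       (trans (++-assoc (block 0 a) (block a d) rest) (cong (block 0 a ++_) (sym (++-assoc (block a d) (block j Q) (block i P ++ block k R)))))) ⟩
    (block 0 a ++ (block a d ++ block j Q) ++ block i P ++ block k R) ∘ₚ τ
  ≡⟨ ++-∘ₚ-σ (block 0 a) (block a d ++ block j Q) (block i P) (block k R)
       (length-block 0 a) (length-offset (length-block₂ a d j Q) (sym (+-assoc a d Q)))
       (length-offset (length-block i P) rearrange) (cong (k +_) (length-block k R)) ⟩
    block 0 a ++ block i P ++ (block a d ++ block j Q) ++ block k R
  ≡⟨ cong (λ w → block 0 a ++ block i P ++ w) (trans (++-assoc (block a d) (block j Q) (block k R))
       (cong (block a d ++_) (sym (block-++ j Q R)))) ⟩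
    block 0 a ++ block i P ++ block a d ++ block j (Q + R)
  ≡⟨ sym (σ≡blocks a d P (Q + R) refl refl (sym (+-assoc j Q R))) ⟩
    σ n a i j
  ∎
  where
  open ≡-Reasoning
  i : ℕ
  i = a + d
  j : ℕ
  j = i + P
  k : ℕ
  k = j + Q
  n : ℕ
  n = k + R
  τ : List ℕ
  τ = σ n a (i + Q) k
  rest : List ℕ
  rest = block j Q ++ block i P ++ block k R
  rearrange : a + d + Q + P ≡ a + d + P + Q
  rearrange = solve (a ∷ d ∷ Q ∷ P ∷ [])

<-offset : ∀ {m n} → m < n → ∃[ o ] m + suc o ≡ n
<-offset {m} m<n with m≤n⇒∃[o]m+o≡n m<n
... | o , eq = o , trans (+-suc m o) eq

offset-≤ : ∀ {m n} o → m + o ≡ n → m ≤ n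
offset-≤ {m} o refl = m≤m+n m o

offset-< : ∀ {m n} o → m + suc o ≡ n → m < n
offset-< {m} o refl = m<m+n m z<s

σ∈T : ∀ {n x y z} → x < y → y < z → z ≤ n → InT n (σ n x y z)
σ∈T p q r = _ , _ , _ , p , q , r , refl

adj-move-i : ∀ {n i i' j k} → i ≢ i' → i < j → i' < j → j < k → k ≤ n → Adj n (σ n i j k) (σ n i' j k)
adj-move-i {i = i} {i'} i≢i' i<j i'<j j<k k≤n with <-cmp i i'
... | tri≈ _ i≡i' _ = ⊥-elim (i≢i' i≡i')
... | tri< i<i' _ _ with <-offset i<i' | <-offset i'<j | <-offset j<k | m≤n⇒∃[o]m+o≡n k≤n
... | d , refl | e , refl | Q , refl | R , refl =
  _ , σ∈T (offset-< Q refl) (offset-< d refl) (offset-≤ (suc e + R) rearrange)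
    , sym (σ-raise-i {i = i} (suc d) (suc e) (suc Q) R (sym (+-assoc i (suc d) (suc e))) refl refl refl refl refl refl)
  where
  rearrange : i + suc Q + suc d + (suc e + R) ≡ i + suc d + suc e + suc Q + R
  rearrange = solve (i ∷ d ∷ e ∷ Q ∷ R ∷ [])
adj-move-i {i = i} {i'} i≢i' i<j i'<j j<k k≤n | tri> _ _ i'<i with <-offset i'<i | <-offset i<j | <-offset j<k | m≤n⇒∃[o]m+o≡n k≤n
... | d , refl | P , refl | Q , refl | R , refl =
  _ , σ∈T (offset-< d refl) (offset-< Q refl) (offset-≤ (suc P + R) rearrange)
    , sym (σ-lower-i i' (suc d) (suc P) (suc Q) R refl refl refl refl refl refl refl)
  where
  rearrange : i' + suc d + suc Q + (suc P + R) ≡ i' + suc d + suc P + suc Q + R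
  rearrange = solve (i' ∷ d ∷ P ∷ Q ∷ R ∷ [])

adj-move-k : ∀ {n i j k k'} → k ≢ k' → i < j → j < k → j < k' → k ≤ n → k' ≤ n → Adj n (σ n i j k) (σ n i j k')
adj-move-k {i = i} {j} {k} {k'} k≢k' i<j j<k j<k' k≤n k'≤n with <-cmp k k'
... | tri≈ _ k≡k' _ = ⊥-elim (k≢k' k≡k')
... | tri< k<k' _ _ with <-offset i<j | <-offset j<k | <-offset k<k' | m≤n⇒∃[o]m+o≡n k'≤n
... | P , refl | Q , refl | e , refl | R , refl =
  _ , σ∈T (offset-< P rearrange) (offset-< e refl) (offset-≤ R refl)
    , sym (σ-raise-k {i = i} (suc P) (suc Q) (suc e) R refl refl refl refl refl refl refl)
  where
  rearrange : i + suc Q + suc P ≡ i + suc P + suc Q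
  rearrange = solve (i ∷ P ∷ Q ∷ [])
adj-move-k {i = i} {j} {k} {k'} k≢k' i<j j<k j<k' k≤n k'≤n | tri> _ _ k'<k with <-offset i<j | <-offset j<k' | <-offset k'<k | m≤n⇒∃[o]m+o≡n k≤n
... | P , refl | d , refl | e , refl | R , refl =
  _ , σ∈T (offset-< e (+-assoc i (suc d) (suc e))) (offset-< P rearrange) (offset-≤ R refl)
    , sym (σ-lower-k {i = i} (suc P) (suc d) (suc e) R refl (sym (+-assoc (i + suc P) (suc d) (suc e))) refl refl refl refl refl)
  where
  rearrange : i + (suc d + suc e) + suc P ≡ i + suc P + suc d + suc e
  rearrange = solve (i ∷ P ∷ d ∷ e ∷ [])

adj-move-j : ∀ {n i j j' k} → j ≢ j' → i < j → j < k → i < j' → j' < k → k ≤ n → Adj n (σ n i j k) (σ n i j' k)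
adj-move-j {i = i} {j} {j'} j≢j' i<j j<k i<j' j'<k k≤n with <-cmp j j'
... | tri≈ _ j≡j' _ = ⊥-elim (j≢j' j≡j')
... | tri< j<j' _ _ with <-offset i<j | <-offset j<j' | <-offset j'<k | m≤n⇒∃[o]m+o≡n k≤n
... | P , refl | d , refl | e , refl | R , refl =
  _ , σ∈T (offset-< d refl) (offset-< (P + suc e) rearrange) (offset-≤ R refl)
    , sym (σ-raise-j {i = i} (suc P) (suc d) (suc e) R refl (sym (+-assoc (i + suc P) (suc d) (suc e))) refl refl refl refl refl)
  where
  rearrange : i + suc d + suc (P + suc e) ≡ i + suc P + suc d + suc e
  rearrange = solve (i ∷ P ∷ d ∷ e ∷ [])
adj-move-j {i = i} {j} {j'} j≢j' i<j j<k i<j' j'<k k≤n | tri> _ _ j'<j with <-offset i<j' | <-offset j'<j | <-offset j<k | m≤n⇒∃[o]m+o≡n k≤n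
... | d , refl | e , refl | Q , refl | R , refl =
  _ , σ∈T (offset-< (Q + suc d) rearrange) (offset-< e rearrange′) (offset-≤ R refl)
    , sym (σ-lower-j {i = i} (suc d) (suc e) (suc Q) R (sym (+-assoc i (suc d) (suc e))) refl refl refl refl refl refl)
  where
  rearrange : i + suc (Q + suc d) ≡ i + suc Q + suc d
  rearrange = solve (i ∷ Q ∷ d ∷ [])
  rearrange′ : i + suc Q + suc d + suc e ≡ i + suc d + suc e + suc Q
  rearrange′ = solve (i ∷ Q ∷ d ∷ e ∷ [])

adj-advance : ∀ {n a b c d} → a < b → b < c → c < d → d ≤ n → Adj n (σ n a b c) (σ n b c d)
adj-advance {a = a} a<b b<c c<d d≤n with <-offset a<b | <-offset b<c | <-offset c<d | m≤n⇒∃[o]m+o≡n d≤n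
... | P , refl | Q , refl | e , refl | R , refl =
  _ , σ∈T (offset-< Q refl) (offset-< (P + suc e) rearrange) (offset-≤ R refl)
    , sym (σ-advance {i = a} (suc P) (suc Q) (suc e) R refl refl refl refl refl refl refl)
  where
  rearrange : a + suc Q + suc (P + suc e) ≡ a + suc P + suc Q + suc e
  rearrange = solve (a ∷ P ∷ Q ∷ e ∷ [])

adj-retreat : ∀ {n a b c d} → a < b → b < c → c < d → d ≤ n → Adj n (σ n b c d) (σ n a b c)
adj-retreat {a = a} a<b b<c c<d d≤n with <-offset a<b | <-offset b<c | <-offset c<d | m≤n⇒∃[o]m+o≡n d≤n
... | e , refl | P , refl | Q , refl | R , refl =
  _ , σ∈T (offset-< (e + suc Q) rearrange) (offset-< P rearrange′) (offset-≤ R refl)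
    , sym (σ-retreat a (suc e) (suc P) (suc Q) R refl refl refl refl refl refl refl)
  where
  rearrange : a + suc (e + suc Q) ≡ a + suc e + suc Q
  rearrange = solve (a ∷ e ∷ Q ∷ [])
  rearrange′ : a + suc e + suc Q + suc P ≡ a + suc e + suc P + suc Q
  rearrange′ = solve (a ∷ e ∷ P ∷ Q ∷ [])

-- Common neighbours

NoCommonNeighbour : ℕ → List ℕ → List ℕ → Set
NoCommonNeighbour n u v = ¬ (∃[ w ] (InT n w × Adj n u w × Adj n v w))

NoCommonNeighbour-sym : ∀ {n u v} → NoCommonNeighbour n u v → NoCommonNeighbour n v u
NoCommonNeighbour-sym none (w , w∈T , v~w , u~w) = none (w , w∈T , u~w , v~w)

SamePair-sym : ∀ {u v a b} → SamePair v u a b → SamePair u v a b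
SamePair-sym (inj₁ (v≡a , u≡b)) = inj₂ (u≡b , v≡a)
SamePair-sym (inj₂ (v≡b , u≡a)) = inj₁ (u≡a , v≡b)

IsSomeE-sym : ∀ {n u v} → IsSomeE n v u → IsSomeE n u v
IsSomeE-sym (inj₁ (l , l+3≤n , e))   = inj₁ (l , l+3≤n , SamePair-sym e)
IsSomeE-sym (inj₂ (inj₁ e))          = inj₂ (inj₁ (SamePair-sym e))
IsSomeE-sym (inj₂ (inj₂ (inj₁ e)))   = inj₂ (inj₂ (inj₁ (SamePair-sym e)))
IsSomeE-sym (inj₂ (inj₂ (inj₂ e)))   = inj₂ (inj₂ (inj₂ (SamePair-sym e)))

avoid-one : ∀ b x → ∃[ z ] (b ≤ z × z ≤ suc b × z ≢ x)
avoid-one b x with b ≟ x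
... | no b≢x  = b , ≤-refl , n≤1+n b , b≢x
... | yes refl = suc b , n≤1+n b , ≤-refl , 1+n≢n

avoid-two : ∀ b x y → ∃[ z ] (b ≤ z × z ≤ 2 + b × z ≢ x × z ≢ y)
avoid-two b x y with b ≟ x | b ≟ y
... | no b≢x | no b≢y = b , ≤-refl , m≤n+m b 2 , b≢x , b≢y
... | yes refl | _ with avoid-one (suc b) y
...   | z , b<z , z≤ , z≢y = z , <⇒≤ b<z , z≤ , ≢-sym (<⇒≢ b<z) , z≢y
avoid-two b x y | no _ | yes refl with avoid-one (suc b) x
...   | z , b<z , z≤ , z≢x = z , <⇒≤ b<z , z≤ , z≢x , ≢-sym (<⇒≢ b<z)

bottom-pair : ∀ {a b} → a < b → b ≤ 1 → a ≡ 0 × b ≡ 1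
bottom-pair (s≤s z≤n) (s≤s z≤n) = refl , refl

bottom-triple : ∀ {a b c} → a < b → b < c → c ≤ 2 → a ≡ 0 × b ≡ 1 × c ≡ 2
bottom-triple (s≤s z≤n) (s≤s (s≤s z≤n)) (s≤s (s≤s z≤n)) = refl , refl , refl

consecutive : ∀ {a b c} → a < b → b < c → c ≤ 2 + a → b ≡ 1 + a × c ≡ 2 + a
consecutive {a} {b} a<b b<c c≤2+a = b≡1+a , ≤-antisym c≤2+a (subst (_< _) b≡1+a b<c)
  where
  b≡1+a : b ≡ 1 + a
  b≡1+a = ≤-antisym (≤-pred (≤-trans b<c c≤2+a)) a<b

maximal-move-i : ∀ {n i i' j k} → i < i' → i' < j → j < k → k ≤ n →
  NoCommonNeighbour n (σ n i j k) (σ n i' j k) → IsSomeE n (σ n i j k) (σ n i' j k)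
maximal-move-i {n} {i} {i'} {j} {k} i<i' i'<j j<k k≤n none with 3 ≤? j
... | yes 3≤j with avoid-two 0 i i'
...   | x , _ , x≤2 , x≢i , x≢i' =
  ⊥-elim (none (σ n x j k , σ∈T x<j j<k k≤n
               , adj-move-i (≢-sym x≢i) (<-trans i<i' i'<j) x<j j<k k≤n , adj-move-i (≢-sym x≢i') i'<j x<j j<k k≤n))
  where
  x<j : x < j
  x<j = <-≤-trans (s≤s x≤2) 3≤j
maximal-move-i {n} {k = k} i<i' i'<j j<k k≤n none | no j≱3 with bottom-triple i<i' i'<j (≤-pred (≰⇒> j≱3))
...   | refl , refl , refl with k ≟ n
...     | yes refl = inj₂ (inj₂ (inj₂ (inj₁ (refl , refl))))
...     | no k≢n = ⊥-elim (none (σ n 2 k (suc k) , σ∈T j<k ≤-refl k<n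
                                , adj-advance z<s j<k ≤-refl k<n , adj-advance i'<j j<k ≤-refl k<n))
  where
  k<n : k < n
  k<n = ≤∧≢⇒< k≤n k≢n

maximal-move-k : ∀ {n i j k k'} → i < j → j < k → k < k' → k' ≤ n →
  NoCommonNeighbour n (σ n i j k) (σ n i j k') → IsSomeE n (σ n i j k) (σ n i j k')
maximal-move-k {n} {i} {j} {k} {k'} i<j j<k k<k' k'≤n none with 3 + j ≤? n
... | yes 3+j≤n with avoid-two (suc j) k k'
...   | z , j<z , z≤3+j , z≢k , z≢k' =
  ⊥-elim (none (σ n i j z , σ∈T i<j j<z z≤n'
               , adj-move-k (≢-sym z≢k) i<j j<k j<z (≤-trans (<⇒≤ k<k') k'≤n) z≤n'
               , adj-move-k (≢-sym z≢k') i<j (<-trans j<k k<k') j<z k'≤n z≤n'))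
  where
  z≤n' : z ≤ n
  z≤n' = ≤-trans z≤3+j 3+j≤n
maximal-move-k {n} {i} {j} i<j j<k k<k' k'≤n none | no 3+j≰n
  with consecutive j<k k<k' (≤-trans k'≤n (≤-pred (≰⇒> 3+j≰n)))
...   | refl , refl with ≤-antisym (≤-pred (≰⇒> 3+j≰n)) k'≤n
...     | refl with i ≟ 0
...       | yes refl = inj₂ (inj₁ (inj₁ (refl , refl)))
...       | no i≢0 = ⊥-elim (none (σ n 0 i j , σ∈T 0<i i<j (≤-trans (<⇒≤ j<k) (<⇒≤ k<k'))
                                  , adj-retreat 0<i i<j j<k (<⇒≤ k<k') , adj-retreat 0<i i<j (<-trans j<k k<k') ≤-refl))
  where
  0<i : 0 < i
  0<i = n≢0⇒n>0 i≢0

maximal-move-j : ∀ {n i j j' k} → i < j → j < j' → j' < k → k ≤ n →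
  NoCommonNeighbour n (σ n i j k) (σ n i j' k) → IsSomeE n (σ n i j k) (σ n i j' k)
maximal-move-j {n} {i} {j} {j'} {k} i<j j<j' j'<k k≤n none with 4 + i ≤? k
... | yes 4+i≤k with avoid-two (suc i) j j'
...   | y , i<y , y≤3+i , y≢j , y≢j' =
  ⊥-elim (none (σ n i y k , σ∈T i<y y<k k≤n
               , adj-move-j (≢-sym y≢j) i<j (<-trans j<j' j'<k) i<y y<k k≤n
               , adj-move-j (≢-sym y≢j') (<-trans i<j j<j') j'<k i<y y<k k≤n))
  where
  y<k : y < k
  y<k = <-≤-trans (s≤s y≤3+i) 4+i≤k
maximal-move-j {n} {i} i<j j<j' j'<k k≤n none | no 4+i≰k
  with consecutive i<j j<j' (≤-pred (≤-trans j'<k (≤-pred (≰⇒> 4+i≰k))))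
...   | refl , refl with ≤-antisym (≤-pred (≰⇒> 4+i≰k)) j'<k
...     | refl = inj₁ (i , subst (_≤ n) (+-comm 3 i) k≤n
                      , inj₁ (cong₂ (σ n i) (+-comm 1 i) (+-comm 3 i) , cong₂ (σ n i) (+-comm 2 i) (+-comm 3 i)))

maximal-advance : ∀ {n a b c d} → a < b → b < c → c < d → d ≤ n →
  NoCommonNeighbour n (σ n a b c) (σ n b c d) → IsSomeE n (σ n a b c) (σ n b c d)
maximal-advance {n} {a} {b} {c} {d} a<b b<c c<d d≤n none with 2 + c ≤? n
... | yes 2+c≤n with avoid-one (suc c) d
...   | z , c<z , z≤2+c , z≢d =
  ⊥-elim (none (σ n b c z , σ∈T b<c c<z z≤n'
               , adj-advance a<b b<c c<z z≤n' , adj-move-k (≢-sym z≢d) b<c c<d c<z d≤n z≤n'))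
  where
  z≤n' : z ≤ n
  z≤n' = ≤-trans z≤2+c 2+c≤n
maximal-advance {n} {a} {b} {c} a<b b<c c<d d≤n none | no 2+c≰n
  with ≤-antisym (≤-trans d≤n (≤-pred (≰⇒> 2+c≰n))) c<d | ≤-antisym (≤-pred (≰⇒> 2+c≰n)) (≤-trans c<d d≤n)
...   | refl | refl with 2 ≤? b
...     | no 2≰b with bottom-pair a<b (≤-pred (≰⇒> 2≰b))
...       | refl , refl = inj₂ (inj₂ (inj₁ (inj₂ (refl , refl))))
maximal-advance {n} {a} {b} {c} a<b b<c c<d d≤n none | no _ | refl | refl | yes 2≤b with avoid-one 0 a
...       | a' , _ , a'≤1 , a'≢a =
  ⊥-elim (none (σ n a' b c , σ∈T a'<b b<c (<⇒≤ c<d)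
               , adj-move-i (≢-sym a'≢a) a<b a'<b b<c (<⇒≤ c<d) , adj-retreat a'<b b<c c<d ≤-refl))
  where
  a'<b : a' < b
  a'<b = <-≤-trans (s≤s a'≤1) 2≤b

data EdgeShape (n : ℕ) : List ℕ → List ℕ → Set where
  move-i  : ∀ {i i' j k} → i < i' → i' < j → j < k → k ≤ n → EdgeShape n (σ n i j k) (σ n i' j k)
  move-j  : ∀ {i j j' k} → i < j → j < j' → j' < k → k ≤ n → EdgeShape n (σ n i j k) (σ n i j' k)
  move-k  : ∀ {i j k k'} → i < j → j < k → k < k' → k' ≤ n → EdgeShape n (σ n i j k) (σ n i j k')
  advance : ∀ {a b c d} → a < b → b < c → c < d → d ≤ n → EdgeShape n (σ n a b c) (σ n b c d)
  flip    : ∀ {u v} → EdgeShape n v u → EdgeShape n u v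

maximal-edge : ∀ {n u v} → EdgeShape n u v → NoCommonNeighbour n u v → IsSomeE n u v
maximal-edge (move-i p q r s)  = maximal-move-i p q r s
maximal-edge (move-j p q r s)  = maximal-move-j p q r s
maximal-edge (move-k p q r s)  = maximal-move-k p q r s
maximal-edge (advance p q r s) = maximal-advance p q r s
maximal-edge {n} {u} {v} (flip e) =
  IsSomeE-sym {n} {u} {v} ∘ maximal-edge e ∘ NoCommonNeighbour-sym {n} {u} {v}

-- Block transpositions as permutations of ℕ

m<m+n+1+o : ∀ m n o → m < m + n + suc o
m<m+n+1+o m n o = ≤-<-trans (m≤m+n m n) (m<m+n (m + n) z<s)

-- The permutation of ℕ underlying σ(i, i+P, i+P+Q) (see at-σ); it fixes 0 and everything beyond
-- i+P+Q, so products can be compared pointwise on all of ℕ.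
σᶠ : ℕ → ℕ → ℕ → ℕ → ℕ
σᶠ i P Q x with x ≤? i
... | yes _ = x
... | no _ with x ≤? i + Q
...   | yes _ = x + P
...   | no _ with x ≤? i + Q + P
...     | yes _ = x ∸ Q
...     | no _  = x

σᶠ-before : ∀ i P Q x → x ≤ i → σᶠ i P Q x ≡ x
σᶠ-before i P Q x x≤i with x ≤? i
... | yes _   = refl
... | no x≰i = ⊥-elim (x≰i x≤i)

σᶠ-first : ∀ i P Q d → d < Q → σᶠ i P Q (i + suc d) ≡ i + suc d + P
σᶠ-first i P Q d d<Q with i + suc d ≤? i
... | yes le = ⊥-elim (m+1+n≰m i le)
... | no _ with i + suc d ≤? i + Q
...   | yes _ = refl
...   | no ≰ = ⊥-elim (≰ (+-monoʳ-≤ i d<Q))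

σᶠ-second : ∀ i P Q d → d < P → σᶠ i P Q (i + Q + suc d) ≡ i + suc d
σᶠ-second i P Q d d<P with i + Q + suc d ≤? i
... | yes le = ⊥-elim (<⇒≱ (m<m+n+1+o i Q d) le)
... | no _ with i + Q + suc d ≤? i + Q
...   | yes le = ⊥-elim (m+1+n≰m (i + Q) le)
...   | no _ with i + Q + suc d ≤? i + Q + P
...     | yes _ = trans (cong (_∸ Q) (xy∙z≈xz∙y i Q (suc d))) (m+n∸n≡m (i + suc d) Q)
...     | no ≰ = ⊥-elim (≰ (+-monoʳ-≤ (i + Q) d<P))

σᶠ-after : ∀ i P Q d → σᶠ i P Q (i + Q + P + suc d) ≡ i + Q + P + suc d
σᶠ-after i P Q d with i + Q + P + suc d ≤? i
... | yes le = ⊥-elim (<⇒≱ (≤-<-trans (m≤m+n i Q) (m<m+n+1+o (i + Q) P d)) le)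
... | no _ with i + Q + P + suc d ≤? i + Q
...   | yes le = ⊥-elim (<⇒≱ (m<m+n+1+o (i + Q) P d) le)
...   | no _ with i + Q + P + suc d ≤? i + Q + P
...     | yes le = ⊥-elim (m+1+n≰m (i + Q + P) le)
...     | no _  = refl

data Region (i P Q x : ℕ) : Set where
  before : x ≤ i → Region i P Q x
  first  : ∀ d → d < Q → x ≡ i + suc d → Region i P Q x
  second : ∀ d → d < P → x ≡ i + Q + suc d → Region i P Q x
  after  : ∀ d → x ≡ i + Q + P + suc d → Region i P Q x

region : ∀ i P Q x → Region i P Q x
region i P Q x with x ≤? i
... | yes x≤i = before x≤i
... | no x≰i with x ≤? i + Q | <-offset (≰⇒> x≰i)
...   | yes x≤i+Q | d , refl = first d (+-cancelˡ-≤ i (suc d) Q x≤i+Q) refl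
...   | no x≰i+Q | _ with x ≤? i + Q + P | <-offset (≰⇒> x≰i+Q)
...     | yes x≤i+Q+P | d , refl = second d (+-cancelˡ-≤ (i + Q) (suc d) P x≤i+Q+P) refl
...     | no x≰i+Q+P | _ with <-offset (≰⇒> x≰i+Q+P)
...       | d , refl = after d refl

at-block : ∀ x d t → t < d → at (block x d) (suc t) ≡ x + suc t
at-block x (suc d) zero    _         = +-comm 1 x
at-block x (suc d) (suc t) (s≤s t<d) = trans (at-block (suc x) d t t<d) (sym (+-suc x (suc t)))

at-++ˡ : ∀ (xs ys : List ℕ) t → t < length xs → at (xs ++ ys) (suc t) ≡ at xs (suc t)
at-++ˡ (x ∷ xs) ys zero    _         = refl
at-++ˡ (x ∷ xs) ys (suc t) (s≤s t<ℓ) = at-++ˡ xs ys t t<ℓ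

at-++ʳ : ∀ (xs ys : List ℕ) t → at (xs ++ ys) (length xs + suc t) ≡ at ys (suc t)
at-++ʳ []            ys t = refl
at-++ʳ (x ∷ [])      ys t = refl
at-++ʳ (x ∷ y ∷ xs)  ys t = at-++ʳ (y ∷ xs) ys t

at-block-++ʳ : ∀ x d (ys : List ℕ) t {m} → d + suc t ≡ m → at (block x d ++ ys) m ≡ at ys (suc t)
at-block-++ʳ x d ys t refl = trans (cong (λ ℓ → at (block x d ++ ys) (ℓ + suc t)) (sym (length-block x d))) (at-++ʳ (block x d) ys t)

at-block-++ˡ : ∀ x d (ys : List ℕ) {m} → 1 ≤ m → m ≤ d → at (block x d ++ ys) m ≡ x + m
at-block-++ˡ x d ys {suc t} _ t<d =
  trans (at-++ˡ (block x d) ys t (subst (t <_) (sym (length-block x d)) t<d)) (at-block x d t t<d)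

at-σ : ∀ {n j k} i P Q R x → i + P ≡ j → j + Q ≡ k → k + R ≡ n → 1 ≤ x → x ≤ n → at (σ n i j k) x ≡ σᶠ i P Q x
at-σ i P Q R x refl refl refl 1≤x x≤n rewrite σ≡blocks i P Q R refl refl refl with region i P Q x
... | before x≤i = begin
  at (B₀ ++ B₁ ++ B₂ ++ B₃) x             ≡⟨ at-block-++ˡ 0 i _ 1≤x x≤i ⟩
  x                                        ≡⟨ σᶠ-before i P Q x x≤i ⟨
  σᶠ i P Q x                               ∎
  where
  open ≡-Reasoning
  B₀ B₁ B₂ B₃ : List ℕ
  B₀ = block 0 i ; B₁ = block (i + P) Q ; B₂ = block i P ; B₃ = block (i + P + Q) R
... | first d d<Q refl = begin
  at (B₀ ++ B₁ ++ B₂ ++ B₃) (i + suc d)   ≡⟨ at-block-++ʳ 0 i _ d refl ⟩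
  at (B₁ ++ B₂ ++ B₃) (suc d)             ≡⟨ at-block-++ˡ (i + P) Q _ (s≤s z≤n) d<Q ⟩
  i + P + suc d                            ≡⟨ xy∙z≈xz∙y i P (suc d) ⟩
  i + suc d + P                            ≡⟨ σᶠ-first i P Q d d<Q ⟨
  σᶠ i P Q (i + suc d)                     ∎
  where
  open ≡-Reasoning
  B₀ B₁ B₂ B₃ : List ℕ
  B₀ = block 0 i ; B₁ = block (i + P) Q ; B₂ = block i P ; B₃ = block (i + P + Q) R
... | second d d<P refl = begin
  at (B₀ ++ B₁ ++ B₂ ++ B₃) (i + Q + suc d) ≡⟨ at-block-++ʳ 0 i _ (Q + d) (solve (i ∷ Q ∷ d ∷ [])) ⟩
  at (B₁ ++ B₂ ++ B₃) (suc (Q + d))         ≡⟨ at-block-++ʳ (i + P) Q _ d (+-suc Q d) ⟩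
  at (B₂ ++ B₃) (suc d)                     ≡⟨ at-block-++ˡ i P _ (s≤s z≤n) d<P ⟩
  i + suc d                                  ≡⟨ σᶠ-second i P Q d d<P ⟨
  σᶠ i P Q (i + Q + suc d)                   ∎
  where
  open ≡-Reasoning
  B₀ B₁ B₂ B₃ : List ℕ
  B₀ = block 0 i ; B₁ = block (i + P) Q ; B₂ = block i P ; B₃ = block (i + P + Q) R
... | after d refl = begin
  at (B₀ ++ B₁ ++ B₂ ++ B₃) (i + Q + P + suc d) ≡⟨ at-block-++ʳ 0 i _ (Q + P + d) (solve (i ∷ Q ∷ P ∷ d ∷ [])) ⟩
  at (B₁ ++ B₂ ++ B₃) (suc (Q + P + d))         ≡⟨ at-block-++ʳ (i + P) Q _ (P + d) (solve (Q ∷ P ∷ d ∷ [])) ⟩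
  at (B₂ ++ B₃) (suc (P + d))                   ≡⟨ at-block-++ʳ i P _ d (+-suc P d) ⟩
  at B₃ (suc d)                                  ≡⟨ at-block (i + P + Q) R d d<R ⟩
  i + P + Q + suc d                              ≡⟨ cong (_+ suc d) (xy∙z≈xz∙y i P Q) ⟩
  i + Q + P + suc d                              ≡⟨ σᶠ-after i P Q d ⟨
  σᶠ i P Q (i + Q + P + suc d)                   ∎
  where
  open ≡-Reasoning
  B₀ B₁ B₂ B₃ : List ℕ
  B₀ = block 0 i ; B₁ = block (i + P) Q ; B₂ = block i P ; B₃ = block (i + P + Q) R
  d<R : d < R
  d<R = +-cancelˡ-< (i + P + Q) d R (subst (_≤ i + P + Q + R) (sym rearrange) x≤n)
    where
    rearrange : suc (i + P + Q + d) ≡ i + Q + P + suc d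
    rearrange = solve (i ∷ P ∷ Q ∷ d ∷ [])

σᶠ-above : ∀ i P Q x → i + Q + P < x → σᶠ i P Q x ≡ x
σᶠ-above i P Q x lt with <-offset lt
... | d , refl = σᶠ-after i P Q d

σᶠ-inverse : ∀ i P Q x → σᶠ i Q P (σᶠ i P Q x) ≡ x
σᶠ-inverse i P Q x with region i P Q x
... | before x≤i     = trans (cong (σᶠ i Q P) (σᶠ-before i P Q x x≤i)) (σᶠ-before i Q P x x≤i)
... | first d d<Q refl = begin
  σᶠ i Q P (σᶠ i P Q (i + suc d)) ≡⟨ cong (σᶠ i Q P) (trans (σᶠ-first i P Q d d<Q) (xy∙z≈xz∙y i (suc d) P)) ⟩
  σᶠ i Q P (i + P + suc d)         ≡⟨ σᶠ-second i Q P d d<Q ⟩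
  i + suc d                        ∎
  where open ≡-Reasoning
... | second d d<P refl = begin
  σᶠ i Q P (σᶠ i P Q (i + Q + suc d)) ≡⟨ cong (σᶠ i Q P) (σᶠ-second i P Q d d<P) ⟩
  σᶠ i Q P (i + suc d)                 ≡⟨ σᶠ-first i Q P d d<P ⟩
  i + suc d + Q                        ≡⟨ xy∙z≈xz∙y i (suc d) Q ⟩
  i + Q + suc d                        ∎
  where open ≡-Reasoning
... | after d refl = begin
  σᶠ i Q P (σᶠ i P Q (i + Q + P + suc d)) ≡⟨ cong (σᶠ i Q P) (trans (σᶠ-after i P Q d) (cong (_+ suc d) (xy∙z≈xz∙y i Q P))) ⟩
  σᶠ i Q P (i + P + Q + suc d)             ≡⟨ σᶠ-after i Q P d ⟩
  i + P + Q + suc d                        ≡⟨ cong (_+ suc d) (xy∙z≈xz∙y i P Q) ⟩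
  i + Q + P + suc d                        ∎
  where open ≡-Reasoning

σᶠ-injective : ∀ i P Q {x y} → σᶠ i P Q x ≡ σᶠ i P Q y → x ≡ y
σᶠ-injective i P Q {x} {y} eq = trans (sym (σᶠ-inverse i P Q x)) (trans (cong (σᶠ i Q P) eq) (σᶠ-inverse i P Q y))

σᶠ-suc : ∀ i P Q x → x ≢ i → x ≢ i + Q → x ≢ i + Q + P → σᶠ i P Q (suc x) ≡ suc (σᶠ i P Q x)
σᶠ-suc i P Q x x≢i x≢m x≢k with region i P Q x
... | before x≤i = trans (σᶠ-before i P Q (suc x) (≤∧≢⇒< x≤i x≢i)) (cong suc (sym (σᶠ-before i P Q x x≤i)))
... | first d d<Q refl = begin
  σᶠ i P Q (suc (i + suc d))  ≡⟨ cong (σᶠ i P Q) (sym (+-suc i (suc d))) ⟩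
  σᶠ i P Q (i + suc (suc d))  ≡⟨ σᶠ-first i P Q (suc d) (≤∧≢⇒< d<Q (x≢m ∘ cong (i +_))) ⟩
  i + suc (suc d) + P         ≡⟨ cong (_+ P) (+-suc i (suc d)) ⟩
  suc (i + suc d + P)         ≡⟨ cong suc (σᶠ-first i P Q d d<Q) ⟨
  suc (σᶠ i P Q (i + suc d))  ∎
  where open ≡-Reasoning
... | second d d<P refl = begin
  σᶠ i P Q (suc (i + Q + suc d)) ≡⟨ cong (σᶠ i P Q) (sym (+-suc (i + Q) (suc d))) ⟩
  σᶠ i P Q (i + Q + suc (suc d)) ≡⟨ σᶠ-second i P Q (suc d) (≤∧≢⇒< d<P (x≢k ∘ cong (i + Q +_))) ⟩
  i + suc (suc d)                ≡⟨ +-suc i (suc d) ⟩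
  suc (i + suc d)                ≡⟨ cong suc (σᶠ-second i P Q d d<P) ⟨
  suc (σᶠ i P Q (i + Q + suc d)) ∎
  where open ≡-Reasoning
... | after d refl =
  trans (σᶠ-above i P Q _ (s≤s (m≤m+n (i + Q + P) (suc d)))) (cong suc (sym (σᶠ-after i P Q d)))

σᶠ-bounded : ∀ i P Q {n x} → i + Q + P ≤ n → 1 ≤ x → x ≤ n → 1 ≤ σᶠ i P Q x × σᶠ i P Q x ≤ n
σᶠ-bounded i P Q {n} {x} i+Q+P≤n 1≤x x≤n with region i P Q x
... | before x≤i = subst (λ y → 1 ≤ y × y ≤ n) (sym (σᶠ-before i P Q x x≤i)) (1≤x , x≤n)
... | first d d<Q refl = subst (λ y → 1 ≤ y × y ≤ n) (sym (σᶠ-first i P Q d d<Q))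
      (≤-trans (s≤s z≤n) (≤-trans (m≤n+m (suc d) i) (m≤m+n (i + suc d) P)) , ≤-trans (+-monoˡ-≤ P (+-monoʳ-≤ i d<Q)) i+Q+P≤n)
... | second d d<P refl = subst (λ y → 1 ≤ y × y ≤ n) (sym (σᶠ-second i P Q d d<P))
      (≤-trans (s≤s z≤n) (m≤n+m (suc d) i) , ≤-trans (≤-trans (+-monoʳ-≤ i d<P) (≤-trans (m≤m+n (i + P) Q) (≤-reflexive (xy∙z≈xz∙y i P Q)))) i+Q+P≤n)
... | after d refl = subst (λ y → 1 ≤ y × y ≤ n) (sym (σᶠ-after i P Q d)) (1≤x , x≤n)

σ-span≤ : ∀ {n i j k} P Q R → i + P ≡ j → j + Q ≡ k → k + R ≡ n → i + Q + P ≤ n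
σ-span≤ {i = i} P Q R refl refl refl = ≤-trans (≤-reflexive (xy∙z≈xz∙y i Q P)) (m≤m+n (i + P + Q) R)

σᶠ-∘ : ∀ {n i j k a b c i' j' k'} P Q R S T U P' Q' R' →
  i + P ≡ j → j + Q ≡ k → k + R ≡ n →
  a + S ≡ b → b + T ≡ c → c + U ≡ n →
  i' + P' ≡ j' → j' + Q' ≡ k' → k' + R' ≡ n →
  σ n i j k ∘ₚ σ n a b c ≡ σ n i' j' k' → ∀ x → σᶠ i P Q (σᶠ a S T x) ≡ σᶠ i' P' Q' x
σᶠ-∘ {i = i} {a = a} {i' = i'} P Q R S T U P' Q' R' e₁ e₂ e₃ f₁ f₂ f₃ g₁ g₂ g₃ eq zero =
  trans (cong (σᶠ i P Q) (σᶠ-before a S T 0 z≤n)) (trans (σᶠ-before i P Q 0 z≤n) (sym (σᶠ-before i' P' Q' 0 z≤n)))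
σᶠ-∘ {n} {i} {j} {k} {a} {b} {c} {i'} {j'} {k'} P Q R S T U P' Q' R' e₁ e₂ e₃ f₁ f₂ f₃ g₁ g₂ g₃ eq (suc x)
  with suc x ≤? n
... | yes x<n = begin
  σᶠ i P Q (σᶠ a S T (suc x))  ≡⟨ at-σ i P Q R _ e₁ e₂ e₃ (proj₁ τx-bounds) (proj₂ τx-bounds) ⟨
  at u (σᶠ a S T (suc x))      ≡⟨ cong (at u) (at-σ a S T U (suc x) f₁ f₂ f₃ (s≤s z≤n) x<n) ⟨
  at u (at τ (suc x))          ≡⟨ at-∘ₚ u τ (suc x) ⟨
  at (u ∘ₚ τ) (suc x)          ≡⟨ cong (λ w → at w (suc x)) eq ⟩
  at (σ n i' j' k') (suc x)    ≡⟨ at-σ i' P' Q' R' (suc x) g₁ g₂ g₃ (s≤s z≤n) x<n ⟩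
  σᶠ i' P' Q' (suc x)          ∎
  where
  open ≡-Reasoning
  u = σ n i j k
  τ : List ℕ
  τ = σ n a b c
  τx-bounds = σᶠ-bounded a S T (σ-span≤ S T U f₁ f₂ f₃) (s≤s z≤n) x<n
... | no x≮n = begin
  σᶠ i P Q (σᶠ a S T (suc x)) ≡⟨ cong (σᶠ i P Q) (σᶠ-above a S T (suc x) (beyond S T U f₁ f₂ f₃)) ⟩
  σᶠ i P Q (suc x)            ≡⟨ σᶠ-above i P Q (suc x) (beyond P Q R e₁ e₂ e₃) ⟩
  suc x                       ≡⟨ σᶠ-above i' P' Q' (suc x) (beyond P' Q' R' g₁ g₂ g₃) ⟨
  σᶠ i' P' Q' (suc x)         ∎
  where
  open ≡-Reasoning
  beyond : ∀ {i j k} P Q R → i + P ≡ j → j + Q ≡ k → k + R ≡ n → i + Q + P < suc x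
  beyond P Q R p q r = ≤-<-trans (σ-span≤ P Q R p q r) (≰⇒> x≮n)

-- Breakpoints

Step : (ℕ → ℕ) → ℕ → Set
Step f x = f (suc x) ≡ suc (f x)

Follows : (ℕ → ℕ) → ℕ → ℕ → Set
Follows f x y = f (suc y) ≡ suc (f x)

OneOf₃ : ℕ → ℕ → ℕ → ℕ → Set
OneOf₃ a b c x = x ≡ a ⊎ x ≡ b ⊎ x ≡ c

OneOf₃? : ∀ a b c x → Dec (OneOf₃ a b c x)
OneOf₃? a b c x = x ≟ a ⊎-dec x ≟ b ⊎-dec x ≟ c

-- For σ(i, j, k) the breakpoints are i, m = i + (k - j) and k.
module BlockMove (i p q : ℕ) where

  F : ℕ → ℕ
  F = σᶠ i (suc p) (suc q)

  m k : ℕ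
  m = i + suc q
  k = m + suc p

  i<m : i < m
  i<m = m<m+n i z<s

  m<k : m < k
  m<k = m<m+n m z<s

  F-i : F i ≡ i
  F-i = σᶠ-before i (suc p) (suc q) i ≤-refl

  F-suc-i : F (suc i) ≡ suc (i + suc p)
  F-suc-i = trans (cong F (+-comm 1 i)) (trans (σᶠ-first i (suc p) (suc q) 0 z<s) (cong (_+ suc p) (+-comm i 1)))

  F-m : F m ≡ k
  F-m = σᶠ-first i (suc p) (suc q) q ≤-refl

  F-suc-m : F (suc m) ≡ suc i
  F-suc-m = trans (cong F (sym (+-comm m 1))) (trans (σᶠ-second i (suc p) (suc q) 0 z<s) (+-comm i 1))

  F-k : F k ≡ i + suc p
  F-k = σᶠ-second i (suc p) (suc q) p ≤-refl

  F-suc-k : F (suc k) ≡ suc k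
  F-suc-k = σᶠ-above i (suc p) (suc q) (suc k) ≤-refl

  F-suc : ∀ {x} → x ≢ i → x ≢ m → x ≢ k → Step F x
  F-suc = σᶠ-suc i (suc p) (suc q) _

  F-injective : ∀ {x y} → F x ≡ F y → x ≡ y
  F-injective = σᶠ-injective i (suc p) (suc q)

  follows-unique : ∀ x {y z} → Follows F x y → Follows F x z → y ≡ z
  follows-unique x f g = suc-injective (F-injective (trans f (sym g)))

  follows-i-m : Follows F i m
  follows-i-m = trans F-suc-m (cong suc (sym F-i))

  follows-m-k : Follows F m k
  follows-m-k = trans F-suc-k (cong suc (sym F-m))

  follows-k-i : Follows F k i
  follows-k-i = trans F-suc-i (cong suc (sym F-k))

  breakpoint⇒cut : ∀ {x} → ¬ Step F x → OneOf₃ i m k x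
  breakpoint⇒cut {x} ¬step with x ≟ i | x ≟ m | x ≟ k
  ... | yes x≡i | _       | _       = inj₁ x≡i
  ... | no _    | yes x≡m | _       = inj₂ (inj₁ x≡m)
  ... | no _    | no _    | yes x≡k = inj₂ (inj₂ x≡k)
  ... | no x≢i  | no x≢m  | no x≢k  = ⊥-elim (¬step (F-suc x≢i x≢m x≢k))

  cut⇒breakpoint : ∀ {x} → OneOf₃ i m k x → ¬ Step F x
  cut⇒breakpoint (inj₁ refl)        step = <⇒≢ i<m (follows-unique i step follows-i-m)
  cut⇒breakpoint (inj₂ (inj₁ refl)) step = <⇒≢ m<k (follows-unique m step follows-m-k)
  cut⇒breakpoint (inj₂ (inj₂ refl)) step = <⇒≢ (<-trans i<m m<k) (sym (follows-unique k step follows-k-i))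

  follows-forward : ∀ {x y} → x < y → Follows F x y → (x ≡ i × y ≡ m) ⊎ (x ≡ m × y ≡ k)
  follows-forward {x} {y} x<y f with x ≟ i | x ≟ m | x ≟ k
  ... | yes refl | _        | _        = inj₁ (refl , follows-unique x f follows-i-m)
  ... | no _     | yes refl | _        = inj₂ (refl , follows-unique x f follows-m-k)
  ... | no _     | no _     | yes refl = ⊥-elim (<-asym (<-trans i<m m<k) (subst (k <_) (follows-unique x f follows-k-i) x<y))
  ... | no x≢i   | no x≢m   | no x≢k   = ⊥-elim (<-irrefl (sym (follows-unique x f (F-suc x≢i x≢m x≢k))) x<y)

  follows-backward : ∀ {x y} → y < x → Follows F x y → x ≡ k × y ≡ i
  follows-backward {x} {y} y<x f with x ≟ i | x ≟ m | x ≟ k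
  ... | yes refl | _        | _        = ⊥-elim (<-asym i<m (subst (_< i) (follows-unique x f follows-i-m) y<x))
  ... | no _     | yes refl | _        = ⊥-elim (<-asym m<k (subst (_< m) (follows-unique x f follows-m-k) y<x))
  ... | no _     | no _     | yes refl = refl , follows-unique x f follows-k-i
  ... | no x≢i   | no x≢m   | no x≢k   = ⊥-elim (<-irrefl (follows-unique x f (F-suc x≢i x≢m x≢k)) y<x)

OneOf₃-lower : ∀ {a b c x} → a < b → b < c → OneOf₃ a b c x → a ≤ x
OneOf₃-lower a<b b<c (inj₁ refl)        = ≤-refl
OneOf₃-lower a<b b<c (inj₂ (inj₁ refl)) = <⇒≤ a<b
OneOf₃-lower a<b b<c (inj₂ (inj₂ refl)) = <⇒≤ (<-trans a<b b<c)

OneOf₃-upper : ∀ {a b c x} → a < b → b < c → OneOf₃ a b c x → x ≤ c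
OneOf₃-upper a<b b<c (inj₁ refl)        = <⇒≤ (<-trans a<b b<c)
OneOf₃-upper a<b b<c (inj₂ (inj₁ refl)) = <⇒≤ b<c
OneOf₃-upper a<b b<c (inj₂ (inj₂ refl)) = ≤-refl

sorted-triple : ∀ {a b c x y z} → a < b → b < c → x < y → y < z →
  OneOf₃ a b c x → OneOf₃ a b c y → OneOf₃ a b c z → x ≡ a × y ≡ b × z ≡ c
sorted-triple a<b b<c x<y y<z ∈x (inj₁ refl)        ∈z = ⊥-elim (<⇒≱ x<y (OneOf₃-lower a<b b<c ∈x))
sorted-triple a<b b<c x<y y<z ∈x (inj₂ (inj₂ refl)) ∈z = ⊥-elim (<⇒≱ y<z (OneOf₃-upper a<b b<c ∈z))
sorted-triple {a} {b} {c} {x} {y} {z} a<b b<c x<y y<z ∈x (inj₂ (inj₁ refl)) ∈z = below ∈x , refl , above ∈z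
  where
  below : OneOf₃ a b c x → x ≡ a
  below (inj₁ x≡a)        = x≡a
  below (inj₂ (inj₁ refl)) = ⊥-elim (<-irrefl refl x<y)
  below (inj₂ (inj₂ refl)) = ⊥-elim (<-asym b<c x<y)
  above : OneOf₃ a b c z → z ≡ c
  above (inj₁ refl)        = ⊥-elim (<-asym a<b y<z)
  above (inj₂ (inj₁ refl)) = ⊥-elim (<-irrefl refl y<z)
  above (inj₂ (inj₂ z≡c))  = z≡c

-- The ways in which two of the points a < b < c of τ can meet the breakpoints i < m < k of u.
data Aligned (i m k a b c : ℕ) : Set where
  ab≡im : a ≡ i → b ≡ m → c ≢ k → Aligned i m k a b c
  ab≡mk : a ≡ m → b ≡ k → Aligned i m k a b c
  ac≡ik : a ≡ i → c ≡ k → b ≢ m → Aligned i m k a b c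
  bc≡im : b ≡ i → c ≡ m → Aligned i m k a b c
  bc≡mk : b ≡ m → c ≡ k → a ≢ i → Aligned i m k a b c

module Alignment (i p q a s t i' p' q' : ℕ)
  (H : ∀ x → σᶠ i (suc p) (suc q) (σᶠ a (suc s) (suc t) x) ≡ σᶠ i' (suc p') (suc q') x) where

  open BlockMove i p q
  module τ = BlockMove a s t
  module v = BlockMove i' p' q'

  -- τ has breakpoints a < a' < c, at which it jumps to b + 1, a + 1 and c + 1.
  b c a' : ℕ
  b  = a + suc s
  a' = τ.m
  c  = τ.k

  a<b : a < b
  a<b = m<m+n a z<s

  b<c : b < c
  b<c = subst (b <_) (xy∙z≈xz∙y a (suc s) (suc t)) (m<m+n b z<s)

  G : ℕ → ℕ
  G x = F (τ.F x)

  step-G⇒v : ∀ {x} → Step G x → Step v.F x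
  step-G⇒v {x} st = trans (sym (H (suc x))) (trans st (cong suc (H x)))

  step-v⇒G : ∀ {x} → Step v.F x → Step G x
  step-v⇒G {x} st = trans (H (suc x)) (trans st (cong suc (sym (H x))))

  G-breakpoint⇒cut : ∀ {x} → ¬ Step G x → OneOf₃ i' v.m v.k x
  G-breakpoint⇒cut ¬st = v.breakpoint⇒cut (¬st ∘ step-v⇒G)

  -- Where τ jumps from z to y + 1, u ∘ τ continues exactly when y follows z in u.
  junction : ∀ {x y z} → τ.F x ≡ z → τ.F (suc x) ≡ suc y → Step G x → Follows F z y
  junction τx τsx st = subst₂ (λ r w → F r ≡ suc (F w)) τsx τx st

  junction⁻¹ : ∀ {x y z} → τ.F x ≡ z → τ.F (suc x) ≡ suc y → Follows F z y → Step G x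
  junction⁻¹ τx τsx f = subst₂ (λ r w → F r ≡ suc (F w)) (sym τsx) (sym τx) f

  follows-a-b : a ≡ i → b ≡ m → Follows F a b
  follows-a-b a≡i b≡m = subst₂ (Follows F) (sym a≡i) (sym b≡m) follows-i-m

  steps-everywhere : a ≡ i → b ≡ m → c ≡ k → ∀ x → Step G x
  steps-everywhere a≡i b≡m c≡k x with x ≟ a | x ≟ a' | x ≟ c
  ... | yes refl | _        | _        = junction⁻¹ τ.F-i τ.F-suc-i (follows-a-b a≡i b≡m)
  ... | no _     | yes refl | _        = junction⁻¹ τ.F-m τ.F-suc-m (subst₂ (Follows F) (sym c≡k) (sym a≡i) follows-k-i)
  ... | no _     | no _     | yes refl = junction⁻¹ τ.F-k τ.F-suc-k (subst₂ (Follows F) (sym b≡m) (sym c≡k) follows-m-k)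
  ... | no x≢a   | no x≢a'  | no x≢c   = trans (cong F (τ.F-suc x≢a x≢a' x≢c)) (F-suc τx≢i τx≢m τx≢k)
    where
    τx≢i : τ.F x ≢ i
    τx≢i e = x≢a (τ.F-injective (trans e (trans (sym a≡i) (sym τ.F-i))))
    τx≢m : τ.F x ≢ m
    τx≢m e = x≢c (τ.F-injective (trans e (trans (sym b≡m) (sym τ.F-k))))
    τx≢k : τ.F x ≢ k
    τx≢k e = x≢a' (τ.F-injective (trans e (trans (sym c≡k) (sym τ.F-m))))

  not-all-aligned : a ≡ i → b ≡ m → c ≢ k
  not-all-aligned a≡i b≡m c≡k = v.cut⇒breakpoint (inj₁ refl) (step-G⇒v (steps-everywhere a≡i b≡m c≡k i'))

  pre : ℕ → ℕ
  pre = σᶠ a (suc t) (suc s)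

  τ-pre : ∀ y → τ.F (pre y) ≡ y
  τ-pre = σᶠ-inverse a (suc t) (suc s)

  pre-avoids : ∀ {y w z} → τ.F w ≡ z → y ≢ z → pre y ≢ w
  pre-avoids {y} τw≡z y≢z pre≡w = y≢z (trans (sym (τ-pre y)) (trans (cong τ.F pre≡w) τw≡z))

  pre-breakpoint : ∀ {y} → OneOf₃ i m k y → pre y ≢ a → pre y ≢ a' → pre y ≢ c → ¬ Step G (pre y)
  pre-breakpoint {y} ∈y ≢a ≢a' ≢c st =
    cut⇒breakpoint ∈y (junction (τ-pre y) (trans (τ.F-suc ≢a ≢a' ≢c) (cong suc (τ-pre y))) st)

  uncovered : ¬ (a ≡ i × b ≡ m) → ∃[ y ] (OneOf₃ i m k y × y ≢ a × y ≢ b × y ≢ c)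
  uncovered ¬ab≡im with OneOf₃? a b c i | OneOf₃? a b c m | OneOf₃? a b c k
  ... | no i∉  | _      | _      = i , inj₁ refl , i∉ ∘ inj₁ , i∉ ∘ inj₂ ∘ inj₁ , i∉ ∘ inj₂ ∘ inj₂
  ... | yes _  | no m∉  | _      = m , inj₂ (inj₁ refl) , m∉ ∘ inj₁ , m∉ ∘ inj₂ ∘ inj₁ , m∉ ∘ inj₂ ∘ inj₂
  ... | yes _  | yes _  | no k∉  = k , inj₂ (inj₂ refl) , k∉ ∘ inj₁ , k∉ ∘ inj₂ ∘ inj₁ , k∉ ∘ inj₂ ∘ inj₂
  ... | yes ∈i | yes ∈m | yes ∈k with sorted-triple a<b b<c i<m m<k ∈i ∈m ∈k
  ...   | i≡a , m≡b , _ = ⊥-elim (¬ab≡im (sym i≡a , sym m≡b))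

  -- If no junction of τ lines up with u, then a, a', c and pre y are four breakpoints of v.
  unlinked-junctions : ¬ Follows F a b → ¬ Follows F c a → ¬ Follows F b c → ⊥
  unlinked-junctions ¬ab ¬ca ¬bc with uncovered (λ (a≡i , b≡m) → ¬ab (follows-a-b a≡i b≡m))
  ... | y , ∈y , y≢a , y≢b , y≢c
    with sorted-triple v.i<m v.m<k τ.i<m τ.m<k (G-breakpoint⇒cut (¬ab ∘ junction τ.F-i τ.F-suc-i))
           (G-breakpoint⇒cut (¬ca ∘ junction τ.F-m τ.F-suc-m)) (G-breakpoint⇒cut (¬bc ∘ junction τ.F-k τ.F-suc-k))
  ...   | a≡i' , a'≡m' , c≡k'
    with G-breakpoint⇒cut (pre-breakpoint ∈y (pre-avoids τ.F-i y≢a) (pre-avoids τ.F-m y≢c) (pre-avoids τ.F-k y≢b))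
  ...     | inj₁ e        = pre-avoids τ.F-i y≢a (trans e (sym a≡i'))
  ...     | inj₂ (inj₁ e) = pre-avoids τ.F-m y≢c (trans e (sym a'≡m'))
  ...     | inj₂ (inj₂ e) = pre-avoids τ.F-k y≢b (trans e (sym c≡k'))

  aligned : Aligned i m k a b c
  aligned with F (suc b) ≟ suc (F a) | F (suc a) ≟ suc (F c) | F (suc c) ≟ suc (F b)
  ... | yes ab | _ | _ with follows-forward a<b ab
  ...   | inj₁ (a≡i , b≡m) = ab≡im a≡i b≡m (not-all-aligned a≡i b≡m)
  ...   | inj₂ (a≡m , b≡k) = ab≡mk a≡m b≡k
  aligned | no ¬ab | yes ca | _ with follows-backward (<-trans a<b b<c) ca
  ...   | c≡k , a≡i = ac≡ik a≡i c≡k (¬ab ∘ follows-a-b a≡i)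
  aligned | no ¬ab | no _ | yes bc with follows-forward b<c bc
  ...   | inj₁ (b≡i , c≡m) = bc≡im b≡i c≡m
  ...   | inj₂ (b≡m , c≡k) = bc≡mk b≡m c≡k (λ a≡i → ¬ab (follows-a-b a≡i b≡m))
  aligned | no ¬ab | no ¬ca | no ¬bc = ⊥-elim (unlinked-junctions ¬ab ¬ca ¬bc)

-- Classification of edges

σ₊ : ℕ → ℕ → ℕ → ℕ → List ℕ
σ₊ n i p q = σ n i (i + suc p) (i + suc p + suc q)

edge-ab≡im : ∀ {n a} i p q s t R U → a ≡ i → a + suc s ≡ i + suc q → a + suc t + suc s ≢ i + suc q + suc p →
  i + suc p + suc q + R ≡ n → a + suc s + suc t + U ≡ n → EdgeShape n (σ₊ n i p q) (σ₊ n i p q ∘ₚ σ₊ n a s t)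
edge-ab≡im {n} i p q s t R U refl b≡m c≢k eR eU with suc-injective (+-cancelˡ-≡ i (suc s) (suc q) b≡m)
... | refl with <-cmp t p
... | tri≈ _ refl _ = ⊥-elim (c≢k (xy∙z≈xz∙y i (suc t) (suc q)))
... | tri< t<p _ _ with <-offset t<p
...   | e , refl =
  subst (EdgeShape n (σ₊ n i p q)) (sym (σ-raise-i {i = i} (suc t) (suc e) (suc q) R refl refl eR refl refl refl refl))
    (move-i (m<m+n i z<s) (offset-< e rearrange) (m<m+n _ z<s) (offset-≤ R eR))
  where
  rearrange : i + suc t + suc e ≡ i + suc (t + suc e)
  rearrange = solve (i ∷ t ∷ e ∷ [])
edge-ab≡im {n} i p q s t R U refl b≡m c≢k eR eU | refl | tri> _ _ p<t with <-offset p<t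
...   | e , refl =
  subst (EdgeShape n (σ₊ n i p q)) (sym (σ-advance {i = i} (suc p) (suc q) (suc e) U refl refl rearrange eU refl refl refl))
    (advance (m<m+n i z<s) (m<m+n _ z<s) (offset-< e rearrange) (offset-≤ U eU))
  where
  rearrange : i + suc p + suc q + suc e ≡ i + suc q + suc (p + suc e)
  rearrange = solve (i ∷ p ∷ q ∷ e ∷ [])

edge-ab≡mk : ∀ {n a} i p q s t R U → a ≡ i + suc q → a + suc s ≡ i + suc q + suc p →
  i + suc p + suc q + R ≡ n → a + suc s + suc t + U ≡ n → EdgeShape n (σ₊ n i p q) (σ₊ n i p q ∘ₚ σ₊ n a s t)
edge-ab≡mk {n} i p q s t R U refl b≡k eR eU with suc-injective (+-cancelˡ-≡ (i + suc q) (suc s) (suc p) b≡k)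
... | refl =
  subst (EdgeShape n (σ₊ n i p q)) (sym (σ-raise-k {i = i} (suc p) (suc q) (suc t) U refl refl rearrange eU refl (xy∙z≈xz∙y i (suc p) (suc q)) refl))
    (move-k (m<m+n i z<s) (m<m+n _ z<s) (offset-< t rearrange) (offset-≤ U eU))
  where
  rearrange : i + suc p + suc q + suc t ≡ i + suc q + suc p + suc t
  rearrange = cong (_+ suc t) (xy∙z≈xz∙y i (suc p) (suc q))

edge-ac≡ik : ∀ {n a} i p q s t R U → a ≡ i → a + suc t + suc s ≡ i + suc q + suc p → a + suc s ≢ i + suc q →
  i + suc p + suc q + R ≡ n → a + suc s + suc t + U ≡ n → EdgeShape n (σ₊ n i p q) (σ₊ n i p q ∘ₚ σ₊ n a s t)
edge-ac≡ik {n} i p q s t R U refl c≡k b≢m eR eU with <-cmp s q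
... | tri≈ _ refl _ = ⊥-elim (b≢m refl)
... | tri< s<q _ _ with <-offset s<q
...   | e , refl =
  subst (EdgeShape n (σ₊ n i p q)) (sym (σ-raise-j (suc p) (suc s) (suc e) R refl refl eR refl refl τ-end refl))
    (move-j (m<m+n i z<s) (m<m+n _ z<s) (offset-< e rearrange) (offset-≤ R eR))
  where
  τ-end : i + suc p + suc (s + suc e) ≡ i + suc s + suc t
  τ-end = trans (xy∙z≈xz∙y i (suc p) (suc (s + suc e))) (trans (sym c≡k) (xy∙z≈xz∙y i (suc t) (suc s)))
  rearrange : i + suc p + suc s + suc e ≡ i + suc p + suc (s + suc e)
  rearrange = solve (i ∷ p ∷ s ∷ e ∷ [])
edge-ac≡ik {n} i p q s t R U refl c≡k b≢m eR eU | tri> _ _ q<s with <-offset q<s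
...   | e , refl with suc-injective (+-cancelˡ-≡ (i + suc q) (suc (e + suc t)) (suc p) (trans rearrange c≡k))
  where
  rearrange : i + suc q + suc (e + suc t) ≡ i + suc t + suc (q + suc e)
  rearrange = solve (i ∷ q ∷ e ∷ t ∷ [])
...   | refl =
  subst (EdgeShape n (σ₊ n i p q)) (sym (σ-lower-j (suc e) (suc t) (suc q) R refl refl eR refl τ-mid τ-end refl))
    (flip (move-j (m<m+n i z<s) (offset-< t rearrange) (m<m+n _ z<s) (offset-≤ R eR)))
  where
  τ-mid : i + suc q + suc e ≡ i + suc (q + suc e)
  τ-mid = solve (i ∷ q ∷ e ∷ [])
  τ-end : i + suc (e + suc t) + suc q ≡ i + suc (q + suc e) + suc t
  τ-end = solve (i ∷ q ∷ e ∷ t ∷ [])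
  rearrange : i + suc e + suc t ≡ i + suc (e + suc t)
  rearrange = solve (i ∷ e ∷ t ∷ [])

edge-bc≡im : ∀ {n i} a p q s t R U → a + suc s ≡ i → a + suc t + suc s ≡ i + suc q →
  i + suc p + suc q + R ≡ n → a + suc s + suc t + U ≡ n → EdgeShape n (σ₊ n i p q) (σ₊ n i p q ∘ₚ σ₊ n a s t)
edge-bc≡im {n} a p q s t R U refl c≡m eR eU with suc-injective (+-cancelˡ-≡ (a + suc s) (suc t) (suc q) (trans (xy∙z≈xz∙y a (suc s) (suc t)) c≡m))
... | refl =
  subst (EdgeShape n (σ₊ n (a + suc s) p q)) (sym (σ-lower-i a (suc s) (suc p) (suc q) R refl refl refl eR refl refl refl))
    (flip (move-i (m<m+n a z<s) (m<m+n _ z<s) (m<m+n _ z<s) (offset-≤ R eR)))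

edge-bc≡mk : ∀ {n a} i p q s t R U → a + suc s ≡ i + suc q → a + suc t + suc s ≡ i + suc q + suc p → a ≢ i →
  i + suc p + suc q + R ≡ n → a + suc s + suc t + U ≡ n → EdgeShape n (σ₊ n i p q) (σ₊ n i p q ∘ₚ σ₊ n a s t)
edge-bc≡mk {n} {a} i p q s t R U b≡m c≡k a≢i eR eU
  with suc-injective (+-cancelˡ-≡ (i + suc q) (suc t) (suc p) (trans (cong (_+ suc t) (sym b≡m)) (trans (xy∙z≈xz∙y a (suc s) (suc t)) c≡k)))
... | refl with <-cmp a i
... | tri≈ _ a≡i _ = ⊥-elim (a≢i a≡i)
... | tri< a<i _ _ with <-offset a<i
...   | d , refl with suc-injective (+-cancelˡ-≡ a (suc s) (suc (d + suc q)) (trans b≡m (solve (a ∷ d ∷ q ∷ []))))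
...   | refl =
  subst (EdgeShape n (σ₊ n (a + suc d) p q)) (sym (σ-retreat a (suc d) (suc p) (suc q) R refl refl refl eR refl τ-mid τ-end))
    (flip (advance (m<m+n a z<s) (m<m+n _ z<s) (m<m+n _ z<s) (offset-≤ R eR)))
  where
  τ-mid : a + suc d + suc q ≡ a + suc (d + suc q)
  τ-mid = solve (a ∷ d ∷ q ∷ [])
  τ-end : a + suc d + suc p + suc q ≡ a + suc (d + suc q) + suc p
  τ-end = solve (a ∷ d ∷ p ∷ q ∷ [])
edge-bc≡mk {n} {a} i p q s t R U b≡m c≡k a≢i eR eU | refl | tri> _ _ i<a with <-offset i<a
...   | d , refl with suc-injective (+-cancelˡ-≡ i (suc q) (suc (d + suc s)) (sym (trans (sym (+-assoc i (suc d) (suc s))) b≡m)))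
...   | refl =
  subst (EdgeShape n (σ₊ n i p q)) (sym (σ-lower-k (suc p) (suc d) (suc s) R refl refl eR refl τ-mid τ-end refl))
    (flip (move-k (m<m+n i z<s) (m<m+n _ z<s) (offset-< s rearrange) (offset-≤ R eR)))
  where
  τ-mid : i + (suc d + suc s) ≡ i + suc d + suc s
  τ-mid = sym (+-assoc i (suc d) (suc s))
  τ-end : i + suc p + suc (d + suc s) ≡ i + suc d + suc s + suc p
  τ-end = solve (i ∷ p ∷ d ∷ s ∷ [])
  rearrange : i + suc p + suc d + suc s ≡ i + suc p + suc (d + suc s)
  rearrange = solve (i ∷ p ∷ d ∷ s ∷ [])

edge-shape : ∀ {n u v} → InT n u → InT n v → Adj n u v → EdgeShape n u v
edge-shape {n} (i , j , k , i<j , j<k , k≤n , refl) (i' , j' , k' , i'<j' , j'<k' , k'≤n , refl)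
               (_ , (a , b , c , a<b , b<c , c≤n , refl) , v≡u∘τ)
  with <-offset i<j | <-offset j<k | <-offset i'<j' | <-offset j'<k' | <-offset a<b | <-offset b<c
     | m≤n⇒∃[o]m+o≡n k≤n | m≤n⇒∃[o]m+o≡n k'≤n | m≤n⇒∃[o]m+o≡n c≤n
... | p , refl | q , refl | p' , refl | q' , refl | s , refl | t , refl | R , eR | R' , eR' | U , eU =
  subst (EdgeShape n (σ₊ n i p q)) (sym v≡u∘τ) (by-alignment (Alignment.aligned i p q a s t i' p' q' pointwise))
  where
  pointwise : ∀ x → σᶠ i (suc p) (suc q) (σᶠ a (suc s) (suc t) x) ≡ σᶠ i' (suc p') (suc q') x
  pointwise = σᶠ-∘ (suc p) (suc q) R (suc s) (suc t) U (suc p') (suc q') R' refl refl eR refl refl eU refl refl eR' (sym v≡u∘τ)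
  by-alignment : Aligned i (i + suc q) (i + suc q + suc p) a (a + suc s) (a + suc t + suc s) →
    EdgeShape n (σ₊ n i p q) (σ₊ n i p q ∘ₚ σ₊ n a s t)
  by-alignment (ab≡im e₁ e₂ e₃) = edge-ab≡im i p q s t R U e₁ e₂ e₃ eR eU
  by-alignment (ab≡mk e₁ e₂)    = edge-ab≡mk i p q s t R U e₁ e₂ eR eU
  by-alignment (ac≡ik e₁ e₂ e₃) = edge-ac≡ik i p q s t R U e₁ e₂ e₃ eR eU
  by-alignment (bc≡im e₁ e₂)    = edge-bc≡im a p q s t R U e₁ e₂ eR eU
  by-alignment (bc≡mk e₁ e₂ e₃) = edge-bc≡mk i p q s t R U e₁ e₂ e₃ eR eU

lemma10 : (n : ℕ) → 3 ≤ n → (u v : List ℕ) → InT n u → InT n v → Adj n u v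
    → ¬ (∃[ w ] (InT n w × Adj n u w × Adj n v w))
    → IsSomeE n u v
lemma10 n _ u v u∈T v∈T u~v = maximal-edge (edge-shape u∈T v∈T u~v)
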